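{- Let $\mathbf R=(R,\oplus,\cdot,0,1)$ be an algebra of type $(2,2,0,0)$. Define $x':=x\oplus 1$, $x\vee y:=(x'y')'$, $x\wedge y:=xy$, and $\mathbb L(\mathbf R):=(R,\vee,\wedge,{}',0,1)$. Then $\mathbf R$ is a ring-like structure of events (RLSE) if and only if $\mathbb L(\mathbf R)$ is an orthomodular lattice and $\oplus$ satisfies: (i) $x\oplus y=y\oplus x$ for all $x,y$; (ii) $x\oplus 1=x'$ for all $x$; (iii) $x\oplus y=x\vee y$ for all $x,y\in R$ with $x\le y'$ (where $\le$ is the partial order induced by the meet-semilattice $(R,\cdot)$, i.e. $x\le y$ iff $xy=x$).
   Context: A ring-like structure of events (RLSE) is an algebra $(R,\oplus,\cdot,0,1)$ of type $(2,2,0,0)$ such that $(R,\cdot,1)$ is an idempotent commutative monoid with zero element $0$ (i.e. $x0=0$ for all $x$), satisfying the identities (R1) $x\oplus y= y\oplus x$; (R2) $(xy\oplus1)(x\oplus1)\oplus1= x$; (R3) $((xy\oplus1)x\oplus1)x= xy$; (R4) $xy\oplus(x\oplus1)=(xy\oplus1)x\oplus1$. -}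

module Defs where

open import Level using (Level)
open import Data.Product using (_×_)
open import Relation.Binary.PropositionalEquality using (_≡_)
open import Algebra.Core using (Op₁; Op₂)
open import Algebra.Definitions using (LeftZero; RightZero)
open import Algebra.Structures using (IsIdempotentCommutativeMonoid)
open import Algebra.Lattice.Structures using (IsLattice)

private variable a : Level

module _ {R : Set a} (_⊕_ _·_ : Op₂ R) (𝟘 𝟙 : R) where

  record IsRLSE : Set a where
    field
      ·-isIdempotentCommutativeMonoid : IsIdempotentCommutativeMonoid _≡_ _·_ 𝟙
      ·-zeroʳ : ∀ x → (x · 𝟘) ≡ 𝟘
      R1 : ∀ x y → (x ⊕ y) ≡ (y ⊕ x)
      R2 : ∀ x y → ((((x · y) ⊕ 𝟙) · (x ⊕ 𝟙)) ⊕ 𝟙) ≡ x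
      R3 : ∀ x y → (((((x · y) ⊕ 𝟙) · x) ⊕ 𝟙) · x) ≡ (x · y)
      R4 : ∀ x y → ((x · y) ⊕ (x ⊕ 𝟙)) ≡ ((((x · y) ⊕ 𝟙) · x) ⊕ 𝟙)

  _′ : Op₁ R
  x ′ = x ⊕ 𝟙

  _∨_ : Op₂ R
  x ∨ y = ((x ′) · (y ′)) ′

  _∧_ : Op₂ R
  x ∧ y = x · y

  _≤_ : R → R → Set a
  x ≤ y = (x · y) ≡ x

-- Orthomodular lattice (L, ∨, ∧, ′, 0, 1), with carrier equality ≡ and
-- order x ≤ y iff x ∧ y = x.
module _ {L : Set a} where

  record IsOrthomodularLattice (_∨_ _∧_ : Op₂ L) (_′ : Op₁ L) (⊥ ⊤ : L) : Set a where
    field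
      isLattice : IsLattice _≡_ _∨_ _∧_
      ⊥-least : ∀ x → (⊥ ∧ x) ≡ ⊥
      ⊤-greatest : ∀ x → (x ∧ ⊤) ≡ x
      ′-involutive : ∀ x → ((x ′) ′) ≡ x
      ′-antitone : ∀ x y → (x ∧ y) ≡ x → ((y ′) ∧ (x ′)) ≡ (y ′)
      complementʳ-∨ : ∀ x → (x ∨ (x ′)) ≡ ⊤
      complementʳ-∧ : ∀ x → (x ∧ (x ′)) ≡ ⊥
      orthomodular : ∀ x y → (x ∧ y) ≡ x → y ≡ (x ∨ (y ∧ (x ′)))

-- Under the dictionary x′ = x ⊕ 1, x ∨ y = (x′y′)′, x ∧ y = xy, the axioms
-- of an RLSE are lattice laws in disguise: (R2) is the absorption law
-- x ∨ xy = x, (R3) is the orthomodular law for the pair x′ ≤ (xy)′, and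
-- (R4) is condition (iii) for the orthogonal pair xy ≤ (x′)′.  Conversely,
-- involutivity of ′ comes from (R2) with y = 1, the complement laws from
-- (R3) with y = 0, and (iii) from (R4) applied to y′ and x.
module Submission where

open import Defs
open import Level using (Level)
open import Data.Product using (_×_; _,_)
open import Function.Bundles using (_⇔_; mk⇔)
open import Relation.Binary.PropositionalEquality
  using (_≡_; refl; sym; trans; cong; cong₂; isEquivalence; module ≡-Reasoning)
open import Algebra.Core using (Op₂)
open import Algebra.Structures using (IsIdempotentCommutativeMonoid)
open import Algebra.Lattice.Bundles using (Lattice)
open import Algebra.Lattice.Structures using (IsLattice)
import Algebra.Lattice.Properties.Lattice as LatticeProperties

module RLSE⇒OrthomodularLattice
  {a : Level} {R : Set a} (_⊕_ _·_ : Op₂ R) (𝟘 𝟙 : R) (rlse : IsRLSE _⊕_ _·_ 𝟘 𝟙) where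

  open IsRLSE rlse
  open IsIdempotentCommutativeMonoid ·-isIdempotentCommutativeMonoid
    using (comm; assoc; idem; identityˡ; identityʳ)
  open ≡-Reasoning

  infix 30 _ᶜ
  _ᶜ : R → R
  x ᶜ = x ⊕ 𝟙

  _∨ᶜ_ : Op₂ R
  x ∨ᶜ y = ((x ᶜ) · (y ᶜ)) ᶜ

  ᶜ-involutive : ∀ x → (x ᶜ) ᶜ ≡ x
  ᶜ-involutive x = begin
    (x ᶜ) ᶜ                    ≡⟨ cong _ᶜ (sym (idem (x ᶜ))) ⟩
    ((x ᶜ) · (x ᶜ)) ᶜ          ≡⟨ cong (λ t → ((t ᶜ) · (x ᶜ)) ᶜ) (sym (identityʳ x)) ⟩
    (((x · 𝟙) ᶜ) · (x ᶜ)) ᶜ    ≡⟨ R2 x 𝟙 ⟩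
    x                          ∎

  [x·y]ᶜ·xᶜ≡xᶜ : ∀ x y → ((x · y) ᶜ) · (x ᶜ) ≡ x ᶜ
  [x·y]ᶜ·xᶜ≡xᶜ x y = trans (sym (ᶜ-involutive _)) (cong _ᶜ (R2 x y))

  ᶜ-antitone : ∀ x y → x · y ≡ x → (y ᶜ) · (x ᶜ) ≡ y ᶜ
  ᶜ-antitone x y x≤y = begin
    (y ᶜ) · (x ᶜ)          ≡⟨ cong (λ t → (y ᶜ) · (t ᶜ)) (sym (trans (comm y x) x≤y)) ⟩
    (y ᶜ) · ((y · x) ᶜ)    ≡⟨ comm _ _ ⟩
    ((y · x) ᶜ) · (y ᶜ)    ≡⟨ [x·y]ᶜ·xᶜ≡xᶜ y x ⟩
    y ᶜ                    ∎

  𝟙ᶜ≡𝟘 : 𝟙 ᶜ ≡ 𝟘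
  𝟙ᶜ≡𝟘 = begin
    𝟙 ᶜ                        ≡⟨ sym ([x·y]ᶜ·xᶜ≡xᶜ 𝟙 (𝟘 ᶜ)) ⟩
    ((𝟙 · (𝟘 ᶜ)) ᶜ) · (𝟙 ᶜ)    ≡⟨ cong (λ t → (t ᶜ) · (𝟙 ᶜ)) (identityˡ _) ⟩
    ((𝟘 ᶜ) ᶜ) · (𝟙 ᶜ)          ≡⟨ cong (_· (𝟙 ᶜ)) (ᶜ-involutive 𝟘) ⟩
    𝟘 · (𝟙 ᶜ)                  ≡⟨ comm _ _ ⟩
    (𝟙 ᶜ) · 𝟘                  ≡⟨ ·-zeroʳ _ ⟩
    𝟘                          ∎

  𝟘ᶜ≡𝟙 : 𝟘 ᶜ ≡ 𝟙
  𝟘ᶜ≡𝟙 = trans (cong _ᶜ (sym 𝟙ᶜ≡𝟘)) (ᶜ-involutive 𝟙)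

  x·xᶜ≡𝟘 : ∀ x → x · (x ᶜ) ≡ 𝟘
  x·xᶜ≡𝟘 x = begin
    x · (x ᶜ)                      ≡⟨ comm _ _ ⟩
    (x ᶜ) · x                      ≡⟨ cong (λ t → (t ᶜ) · x) (sym (identityˡ x)) ⟩
    ((𝟙 · x) ᶜ) · x                ≡⟨ cong (λ t → ((t · x) ᶜ) · x) (sym 𝟘ᶜ≡𝟙) ⟩
    (((𝟘 ᶜ) · x) ᶜ) · x            ≡⟨ cong (λ t → (((t ᶜ) · x) ᶜ) · x) (sym (·-zeroʳ x)) ⟩
    ((((x · 𝟘) ᶜ) · x) ᶜ) · x      ≡⟨ R3 x 𝟘 ⟩
    x · 𝟘                          ≡⟨ ·-zeroʳ x ⟩
    𝟘                              ∎

  x∨ᶜxᶜ≡𝟙 : ∀ x → x ∨ᶜ (x ᶜ) ≡ 𝟙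
  x∨ᶜxᶜ≡𝟙 x = begin
    ((x ᶜ) · ((x ᶜ) ᶜ)) ᶜ    ≡⟨ cong (λ t → ((x ᶜ) · t) ᶜ) (ᶜ-involutive x) ⟩
    ((x ᶜ) · x) ᶜ            ≡⟨ cong _ᶜ (trans (comm _ _) (x·xᶜ≡𝟘 x)) ⟩
    𝟘 ᶜ                      ≡⟨ 𝟘ᶜ≡𝟙 ⟩
    𝟙                        ∎

  ∨ᶜ-assoc : ∀ x y z → (x ∨ᶜ y) ∨ᶜ z ≡ x ∨ᶜ (y ∨ᶜ z)
  ∨ᶜ-assoc x y z = cong _ᶜ (begin
    ((((x ᶜ) · (y ᶜ)) ᶜ) ᶜ) · (z ᶜ)    ≡⟨ cong (_· (z ᶜ)) (ᶜ-involutive _) ⟩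
    ((x ᶜ) · (y ᶜ)) · (z ᶜ)            ≡⟨ assoc _ _ _ ⟩
    (x ᶜ) · ((y ᶜ) · (z ᶜ))            ≡⟨ cong ((x ᶜ) ·_) (sym (ᶜ-involutive _)) ⟩
    (x ᶜ) · ((((y ᶜ) · (z ᶜ)) ᶜ) ᶜ)    ∎)

  ∨ᶜ-absorbs-· : ∀ x y → x ∨ᶜ (x · y) ≡ x
  ∨ᶜ-absorbs-· x y = trans (cong _ᶜ (trans (comm _ _) ([x·y]ᶜ·xᶜ≡xᶜ x y))) (ᶜ-involutive x)

  ·-absorbs-∨ᶜ : ∀ x y → x · (x ∨ᶜ y) ≡ x
  ·-absorbs-∨ᶜ x y = begin
    x · (x ∨ᶜ y)             ≡⟨ cong (_· (x ∨ᶜ y)) (sym (ᶜ-involutive x)) ⟩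
    ((x ᶜ) ᶜ) · (x ∨ᶜ y)     ≡⟨ ᶜ-antitone ((x ᶜ) · (y ᶜ)) (x ᶜ) xᶜ·yᶜ≤xᶜ ⟩
    (x ᶜ) ᶜ                  ≡⟨ ᶜ-involutive x ⟩
    x                        ∎
    where
    xᶜ·yᶜ≤xᶜ : ((x ᶜ) · (y ᶜ)) · (x ᶜ) ≡ (x ᶜ) · (y ᶜ)
    xᶜ·yᶜ≤xᶜ = trans (comm _ _) (trans (sym (assoc _ _ _)) (cong (_· (y ᶜ)) (idem _)))

  isLattice : IsLattice _≡_ _∨ᶜ_ _·_
  isLattice = record
    { isEquivalence = isEquivalence
    ; ∨-comm        = λ x y → cong _ᶜ (comm _ _)
    ; ∨-assoc       = ∨ᶜ-assoc
    ; ∨-cong        = cong₂ _∨ᶜ_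
    ; ∧-comm        = comm
    ; ∧-assoc       = assoc
    ; ∧-cong        = cong₂ _·_
    ; absorptive    = ∨ᶜ-absorbs-· , ·-absorbs-∨ᶜ
    }

  orthomodular : ∀ x y → x · y ≡ x → y ≡ x ∨ᶜ (y · (x ᶜ))
  orthomodular x y x≤y = begin
    y                              ≡⟨ sym (ᶜ-involutive y) ⟩
    (y ᶜ) ᶜ                        ≡⟨ cong _ᶜ (sym xᶜ·[y·xᶜ]ᶜ≡yᶜ) ⟩
    ((x ᶜ) · ((y · (x ᶜ)) ᶜ)) ᶜ    ∎
    where
    xᶜ·yᶜ≡yᶜ : (x ᶜ) · (y ᶜ) ≡ y ᶜ
    xᶜ·yᶜ≡yᶜ = trans (comm _ _) (ᶜ-antitone x y x≤y)

    xᶜ·[y·xᶜ]ᶜ≡yᶜ : (x ᶜ) · ((y · (x ᶜ)) ᶜ) ≡ y ᶜ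
    xᶜ·[y·xᶜ]ᶜ≡yᶜ = begin
      (x ᶜ) · ((y · (x ᶜ)) ᶜ)                      ≡⟨ comm _ _ ⟩
      ((y · (x ᶜ)) ᶜ) · (x ᶜ)                      ≡⟨ cong (λ t → ((t · (x ᶜ)) ᶜ) · (x ᶜ)) (sym (ᶜ-involutive y)) ⟩
      ((((y ᶜ) ᶜ) · (x ᶜ)) ᶜ) · (x ᶜ)              ≡⟨ cong (λ t → (((t ᶜ) · (x ᶜ)) ᶜ) · (x ᶜ)) (sym xᶜ·yᶜ≡yᶜ) ⟩
      (((((x ᶜ) · (y ᶜ)) ᶜ) · (x ᶜ)) ᶜ) · (x ᶜ)    ≡⟨ R3 (x ᶜ) (y ᶜ) ⟩
      (x ᶜ) · (y ᶜ)                                ≡⟨ xᶜ·yᶜ≡yᶜ ⟩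
      y ᶜ                                          ∎

  isOrthomodularLattice : IsOrthomodularLattice (_∨_ _⊕_ _·_ 𝟘 𝟙) (_∧_ _⊕_ _·_ 𝟘 𝟙) (_′ _⊕_ _·_ 𝟘 𝟙) 𝟘 𝟙
  isOrthomodularLattice = record
    { isLattice     = isLattice
    ; ⊥-least       = λ x → trans (comm _ _) (·-zeroʳ x)
    ; ⊤-greatest    = identityʳ
    ; ′-involutive  = ᶜ-involutive
    ; ′-antitone    = ᶜ-antitone
    ; complementʳ-∨ = x∨ᶜxᶜ≡𝟙
    ; complementʳ-∧ = x·xᶜ≡𝟘
    ; orthomodular  = orthomodular
    }

  ⊕-orthogonal : ∀ x y → x · (y ᶜ) ≡ x → x ⊕ y ≡ x ∨ᶜ y
  ⊕-orthogonal x y x≤yᶜ = begin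
    x ⊕ y                              ≡⟨ cong₂ _⊕_ (sym yᶜ·x≡x) (sym (ᶜ-involutive y)) ⟩
    ((y ᶜ) · x) ⊕ ((y ᶜ) ᶜ)            ≡⟨ R4 (y ᶜ) x ⟩
    ((((y ᶜ) · x) ᶜ) · (y ᶜ)) ᶜ        ≡⟨ cong (λ t → ((t ᶜ) · (y ᶜ)) ᶜ) yᶜ·x≡x ⟩
    x ∨ᶜ y                             ∎
    where
    yᶜ·x≡x : (y ᶜ) · x ≡ x
    yᶜ·x≡x = trans (comm _ _) x≤yᶜ

module OrthomodularLattice⇒RLSE
  {a : Level} {R : Set a} (_⊕_ _·_ : Op₂ R) (𝟘 𝟙 : R)
  (oml : IsOrthomodularLattice (_∨_ _⊕_ _·_ 𝟘 𝟙) (_∧_ _⊕_ _·_ 𝟘 𝟙) (_′ _⊕_ _·_ 𝟘 𝟙) 𝟘 𝟙)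
  (⊕-comm : ∀ x y → x ⊕ y ≡ y ⊕ x)
  (⊕-orthogonal : ∀ x y → _≤_ _⊕_ _·_ 𝟘 𝟙 x (_′ _⊕_ _·_ 𝟘 𝟙 y) → x ⊕ y ≡ _∨_ _⊕_ _·_ 𝟘 𝟙 x y) where

  open IsOrthomodularLattice oml
  open IsLattice isLattice using (∧-comm; ∧-assoc; ∨-absorbs-∧)
  open ≡-Reasoning

  lattice : Lattice a a
  lattice = record { isLattice = isLattice }

  open LatticeProperties lattice using (∧-idem; ∧-isSemigroup)

  infix 30 _ᶜ
  _ᶜ : R → R
  x ᶜ = x ⊕ 𝟙

  ·-identityˡ : ∀ x → 𝟙 · x ≡ x
  ·-identityˡ x = trans (∧-comm 𝟙 x) (⊤-greatest x)

  ·-isIdempotentCommutativeMonoid : IsIdempotentCommutativeMonoid _≡_ _·_ 𝟙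
  ·-isIdempotentCommutativeMonoid = record
    { isCommutativeMonoid = record
      { isMonoid = record
        { isSemigroup = ∧-isSemigroup
        ; identity    = ·-identityˡ , ⊤-greatest
        }
      ; comm = ∧-comm
      }
    ; idem = ∧-idem
    }

  x·y≤x : ∀ x y → (x · y) · x ≡ x · y
  x·y≤x x y = begin
    (x · y) · x    ≡⟨ ∧-comm _ _ ⟩
    x · (x · y)    ≡⟨ sym (∧-assoc _ _ _) ⟩
    (x · x) · y    ≡⟨ cong (_· y) (∧-idem x) ⟩
    x · y          ∎

  R2 : ∀ x y → ((((x · y) ᶜ) · (x ᶜ)) ᶜ) ≡ x
  R2 x y = trans (cong _ᶜ (∧-comm _ _)) (∨-absorbs-∧ x y)

  R3 : ∀ x y → ((((x · y) ᶜ) · x) ᶜ) · x ≡ x · y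
  R3 x y = sym (begin
    x · y                                               ≡⟨ sym (′-involutive _) ⟩
    ((x · y) ᶜ) ᶜ                                       ≡⟨ cong _ᶜ (orthomodular (x ᶜ) ((x · y) ᶜ) xᶜ≤[x·y]ᶜ) ⟩
    ((((x ᶜ) ᶜ) · ((((x · y) ᶜ) · ((x ᶜ) ᶜ)) ᶜ)) ᶜ) ᶜ   ≡⟨ ′-involutive _ ⟩
    ((x ᶜ) ᶜ) · ((((x · y) ᶜ) · ((x ᶜ) ᶜ)) ᶜ)           ≡⟨ cong (λ t → t · ((((x · y) ᶜ) · t) ᶜ)) (′-involutive x) ⟩
    x · ((((x · y) ᶜ) · x) ᶜ)                           ≡⟨ ∧-comm _ _ ⟩
    ((((x · y) ᶜ) · x) ᶜ) · x                           ∎)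
    where
    xᶜ≤[x·y]ᶜ : (x ᶜ) · ((x · y) ᶜ) ≡ x ᶜ
    xᶜ≤[x·y]ᶜ = ′-antitone (x · y) x (x·y≤x x y)

  R4 : ∀ x y → (x · y) ⊕ (x ᶜ) ≡ (((x · y) ᶜ) · x) ᶜ
  R4 x y = begin
    (x · y) ⊕ (x ᶜ)                      ≡⟨ ⊕-orthogonal (x · y) (x ᶜ) x·y≤xᶜᶜ ⟩
    (((x · y) ᶜ) · ((x ᶜ) ᶜ)) ᶜ          ≡⟨ cong (λ t → (((x · y) ᶜ) · t) ᶜ) (′-involutive x) ⟩
    (((x · y) ᶜ) · x) ᶜ                  ∎
    where
    x·y≤xᶜᶜ : (x · y) · ((x ᶜ) ᶜ) ≡ x · y
    x·y≤xᶜᶜ = trans (cong ((x · y) ·_) (′-involutive x)) (x·y≤x x y)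

  isRLSE : IsRLSE _⊕_ _·_ 𝟘 𝟙
  isRLSE = record
    { ·-isIdempotentCommutativeMonoid = ·-isIdempotentCommutativeMonoid
    ; ·-zeroʳ = λ x → trans (∧-comm x 𝟘) (⊥-least x)
    ; R1      = ⊕-comm
    ; R2      = R2
    ; R3      = R3
    ; R4      = R4
    }

theorem2p1 : ∀ {a : Level} {R : Set a} (_⊕_ _·_ : Op₂ R) (𝟘 𝟙 : R) →
    IsRLSE _⊕_ _·_ 𝟘 𝟙 ⇔
      (IsOrthomodularLattice (_∨_ _⊕_ _·_ 𝟘 𝟙) (_∧_ _⊕_ _·_ 𝟘 𝟙) (_′ _⊕_ _·_ 𝟘 𝟙) 𝟘 𝟙
        × (∀ x y → (x ⊕ y) ≡ (y ⊕ x))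
        × (∀ x → (x ⊕ 𝟙) ≡ _′ _⊕_ _·_ 𝟘 𝟙 x)
        × (∀ x y → _≤_ _⊕_ _·_ 𝟘 𝟙 x (_′ _⊕_ _·_ 𝟘 𝟙 y) → (x ⊕ y) ≡ _∨_ _⊕_ _·_ 𝟘 𝟙 x y))
theorem2p1 _⊕_ _·_ 𝟘 𝟙 = mk⇔
  (λ rlse → let open RLSE⇒OrthomodularLattice _⊕_ _·_ 𝟘 𝟙 rlse in
    isOrthomodularLattice , IsRLSE.R1 rlse , (λ x → refl) , ⊕-orthogonal)
  (λ (oml , ⊕-comm , _ , ⊕-orthogonal) →
    OrthomodularLattice⇒RLSE.isRLSE _⊕_ _·_ 𝟘 𝟙 oml ⊕-comm ⊕-orthogonal)
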